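{- For every $n\in\mathbb N$, the map $\mathrm{Syn}(\mathsf{Glob})(\Gamma,S^{n-1})\to\{A\in\mathrm{Ty}^\Gamma:\dim A=n-1\}$, $\sigma\mapsto U_n[\sigma]$, is a bijection natural in $\Gamma$; writing $\chi_A$ for the substitution corresponding to a type $A$, the map from the set of morphisms $\sigma:\Gamma\to D^n$ with $\pi\circ\sigma=\chi_A$ (i.e. morphisms from $\chi_A$ to $\pi:D^n\to S^{n-1}$ in the slice $\mathrm{Syn}(\mathsf{Glob})/S^{n-1}$) to $\mathrm{Tm}^\Gamma_A$, $\sigma\mapsto d_{2n}[\sigma]$, is also a natural bijection.
   Context: $\mathsf{Glob}$ is the type theory whose terms are variables, whose types are $\star$ or $t\to_Au$, with rules: empty context valid; $\Gamma\vdash A$, $x$ fresh give $(\Gamma,x:A)\vdash$; $\Gamma\vdash$ gives $\Gamma\vdash\star$; $\Gamma\vdash A$, $\Gamma\vdash t:A$, $\Gamma\vdash u:A$ give $\Gamma\vdash t\to_Au$; $\Gamma\vdash$ and $(x:A)\in\Gamma$ give $\Gamma\vdash x:A$; substitution rules $\Delta\vdash\langle\rangle:()$ and $\Delta\vdash\langle\gamma,x\mapsto t\rangle:(\Gamma,x:A)$ from $\Delta\vdash\gamma:\Gamma$, $(\Gamma,x:A)\vdash$, $\Delta\vdash t:A[\gamma]$. $\mathrm{Syn}(\mathsf{Glob})$: derivable contexts (up to renaming) and derivable substitutions; $\mathrm{Ty}^\Gamma$ the derivable types in $\Gamma$, $\mathrm{Tm}^\Gamma_A$ the terms of type $A$.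 $\dim\star=-1$, $\dim(t\to_Au)=\dim A+1$. Disk and sphere contexts (with distinct variables $d_i$): $S^{ -1}=()$, $D^n=(S^{n-1},d_{2n}:U_n)$, $S^n=(D^n,d_{2n+1}:U_n)$, where $U_0=\star$ and $U_{n+1}=d_{2n}\to_{U_n}d_{2n+1}$; $\pi:D^n\to S^{n-1}$ is the projection (identity on the variables of $S^{n-1}$). -}

module Defs where

open import Data.Nat using (ℕ; zero; suc; _*_; _≡ᵇ_)
open import Data.Integer using (ℤ; +_; -[1+_]) renaming (_+_ to _+ℤ_)
open import Data.Bool using (if_then_else_)
open import Data.Product using (_×_)
open import Data.Unit using (⊤)
open import Relation.Binary.PropositionalEquality using (_≢_)

-- Raw syntax of Glob.  Variables are natural numbers; the disk/sphere
-- variable d_i is the variable i.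

data Tm : Set where
  var : ℕ → Tm

data Ty : Set where
  ⋆   : Ty
  arr : Ty → Tm → Tm → Ty      -- arr A t u  is  t →_A u

data Ctx : Set where
  ∅     : Ctx
  _,_∶_ : Ctx → ℕ → Ty → Ctx

data Sub : Set where
  ⟨⟩      : Sub
  ⟨_,_↦_⟩ : Sub → ℕ → Tm → Sub

_∉_ : ℕ → Ctx → Set
x ∉ ∅ = ⊤
x ∉ (Γ , y ∶ A) = (x ≢ y) × (x ∉ Γ)

data _∶_∈_ : ℕ → Ty → Ctx → Set where
  here  : ∀ {Γ x A} → x ∶ A ∈ (Γ , x ∶ A)
  there : ∀ {Γ x A y B} → x ∶ A ∈ Γ → x ∶ A ∈ (Γ , y ∶ B)

-- Action of substitutions (a variable not in the domain is left unchanged;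
-- this never happens for derivable substitutions).
_[_]tm : Tm → Sub → Tm
var x [ ⟨⟩ ]tm = var x
var x [ ⟨ γ , y ↦ t ⟩ ]tm = if x ≡ᵇ y then t else (var x [ γ ]tm)

_[_]ty : Ty → Sub → Ty
⋆ [ γ ]ty = ⋆
arr A t u [ γ ]ty = arr (A [ γ ]ty) (t [ γ ]tm) (u [ γ ]tm)

-- composition in Syn(Glob):  γ : Γ → Θ,  θ : Δ → Γ  gives  γ ∘s θ : Δ → Θ
_∘s_ : Sub → Sub → Sub
⟨⟩ ∘s θ = ⟨⟩
⟨ γ , x ↦ t ⟩ ∘s θ = ⟨ γ ∘s θ , x ↦ t [ θ ]tm ⟩

data _⊢ : Ctx → Set
data _⊢ty_ : Ctx → Ty → Set
data _⊢_∶_ : Ctx → Tm → Ty → Set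

data _⊢ where
  ctx-∅   : ∅ ⊢
  ctx-ext : ∀ {Γ x A} → Γ ⊢ty A → x ∉ Γ → (Γ , x ∶ A) ⊢

data _⊢ty_ where
  ty-⋆   : ∀ {Γ} → Γ ⊢ → Γ ⊢ty ⋆
  ty-arr : ∀ {Γ A t u} → Γ ⊢ty A → Γ ⊢ t ∶ A → Γ ⊢ u ∶ A → Γ ⊢ty arr A t u

data _⊢_∶_ where
  tm-var : ∀ {Γ x A} → Γ ⊢ → x ∶ A ∈ Γ → Γ ⊢ var x ∶ A

data _⊢s_∶_ : Ctx → Sub → Ctx → Set where
  sub-⟨⟩  : ∀ {Δ} → Δ ⊢s ⟨⟩ ∶ ∅
  sub-ext : ∀ {Δ γ Γ x A t} → Δ ⊢s γ ∶ Γ → (Γ , x ∶ A) ⊢ → Δ ⊢ t ∶ (A [ γ ]ty) →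
            Δ ⊢s ⟨ γ , x ↦ t ⟩ ∶ (Γ , x ∶ A)

dim : Ty → ℤ
dim ⋆ = -[1+ 0 ]
dim (arr A t u) = dim A +ℤ + 1

U : ℕ → Ty
U zero = ⋆
U (suc n) = arr (U n) (var (2 * n)) (var (suc (2 * n)))

-- Sphere n = S^{n-1}  (so Sphere 0 = S^{-1} = ()),  Disk n = D^n
Sphere : ℕ → Ctx
Disk   : ℕ → Ctx
Sphere zero = ∅
Sphere (suc n) = Disk n , suc (2 * n) ∶ U n
Disk n = Sphere n , 2 * n ∶ U n

idSub : Ctx → Sub
idSub ∅ = ⟨⟩
idSub (Γ , x ∶ A) = ⟨ idSub Γ , x ↦ var x ⟩

π : ℕ → Sub
π n = idSub (Sphere n)

module Submission where

-- A substitution into Sphere n is a tower ⟨ ⟨ … , 2k ↦ a ⟩ , 2k+1 ↦ b ⟩ of pairs of parallel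
-- terms, and U n [ σ ] reassembles the tower into the iterated arrow type; conversely a type
-- of dimension n - 1 is peeled down to ⋆ to recover the tower.  A substitution into
-- Disk n = Sphere n , 2n ∶ U n adds one more term of type U n [ χ ]: π forgets it and
-- d₂ₙ reads it off.  Naturality is the substitution lemma t [ σ ∘s θ ] = t [ σ ] [ θ ] for
-- terms typed in the codomain context of σ.

open import Defs
open import Data.Nat using (ℕ; zero; suc; _*_; _≡ᵇ_; _≤_)
open import Data.Nat.Properties using (≤-refl; ≤-trans; n≤1+n; <⇒≢; *-suc; +-comm; ≡ᵇ⇒≡; ≡⇒≡ᵇ)
open import Data.Integer using (+_) renaming (_-_ to _-ℤ_; _+_ to _+ℤ_)
open import Data.Bool using (true; false)
open import Data.Unit using (tt)
open import Data.Product using (_×_; Σ; _,_)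
open import Relation.Nullary using (contradiction)
open import Relation.Binary.PropositionalEquality
  using (_≡_; _≢_; refl; sym; trans; cong; cong₂; subst; subst₂)

arr-cong : ∀ {A B t t′ u u′} → A ≡ B → t ≡ t′ → u ≡ u′ → arr A t u ≡ arr B t′ u′
arr-cong refl refl refl = refl

arr-injective : ∀ {A B t t′ u u′} → arr A t u ≡ arr B t′ u′ → (A ≡ B) × (t ≡ t′) × (u ≡ u′)
arr-injective refl = refl , refl , refl

var-[↦]-same : ∀ x γ t → var x [ ⟨ γ , x ↦ t ⟩ ]tm ≡ t
var-[↦]-same x γ t with x ≡ᵇ x | ≡⇒≡ᵇ x x refl
... | true | _ = refl

var-[↦]-other : ∀ {x y} γ t → x ≢ y → var x [ ⟨ γ , y ↦ t ⟩ ]tm ≡ var x [ γ ]tm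
var-[↦]-other {x} {y} γ t x≢y with x ≡ᵇ y | ≡ᵇ⇒≡ x y
... | false | _   = refl
... | true  | x≡y = contradiction (x≡y tt) x≢y

∈-∉⇒≢ : ∀ {Γ x y A} → x ∶ A ∈ Γ → y ∉ Γ → x ≢ y
∈-∉⇒≢ here      (y≢x , _) x≡y = y≢x (sym x≡y)
∈-∉⇒≢ (there m) (_ , y∉)      = ∈-∉⇒≢ m y∉

[↦]tm-fresh : ∀ {Γ t A x γ s} → Γ ⊢ t ∶ A → x ∉ Γ → t [ ⟨ γ , x ↦ s ⟩ ]tm ≡ t [ γ ]tm
[↦]tm-fresh {γ = γ} {s} (tm-var _ m) x∉ = var-[↦]-other γ s (∈-∉⇒≢ m x∉)

[↦]ty-fresh : ∀ {Γ A x γ s} → Γ ⊢ty A → x ∉ Γ → A [ ⟨ γ , x ↦ s ⟩ ]ty ≡ A [ γ ]ty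
[↦]ty-fresh (ty-⋆ _)       x∉ = refl
[↦]ty-fresh (ty-arr a t u) x∉ = arr-cong ([↦]ty-fresh a x∉) ([↦]tm-fresh t x∉) ([↦]tm-fresh u x∉)

wk-tm : ∀ {Γ x B t A} → (Γ , x ∶ B) ⊢ → Γ ⊢ t ∶ A → (Γ , x ∶ B) ⊢ t ∶ A
wk-tm wf (tm-var _ m) = tm-var wf (there m)

wk-ty : ∀ {Γ x B A} → (Γ , x ∶ B) ⊢ → Γ ⊢ty A → (Γ , x ∶ B) ⊢ty A
wk-ty wf (ty-⋆ _)       = ty-⋆ wf
wk-ty wf (ty-arr a t u) = ty-arr (wk-ty wf a) (wk-tm wf t) (wk-tm wf u)

⊢ty⇒⊢ : ∀ {Γ A} → Γ ⊢ty A → Γ ⊢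
⊢ty⇒⊢ (ty-⋆ wf)       = wf
⊢ty⇒⊢ (ty-arr a _ _) = ⊢ty⇒⊢ a

∈⇒⊢ty : ∀ {Γ x A} → Γ ⊢ → x ∶ A ∈ Γ → Γ ⊢ty A
∈⇒⊢ty wf@(ctx-ext a _) here      = wk-ty wf a
∈⇒⊢ty wf@(ctx-ext a _) (there m) = wk-ty wf (∈⇒⊢ty (⊢ty⇒⊢ a) m)

var-[]-⊢ : ∀ {Δ σ Γ x A} → Δ ⊢s σ ∶ Γ → x ∶ A ∈ Γ → Δ ⊢ var x [ σ ]tm ∶ (A [ σ ]ty)
var-[]-⊢ {Δ} (sub-ext {γ = γ} {x = x} {t = t} _ (ctx-ext a x∉) ⊢t) here =
  subst₂ (Δ ⊢_∶_) (sym (var-[↦]-same x γ t)) (sym ([↦]ty-fresh a x∉)) ⊢t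
var-[]-⊢ {Δ} (sub-ext {γ = γ} {t = t} ⊢γ (ctx-ext a x∉) _) (there m) =
  subst₂ (Δ ⊢_∶_) (sym (var-[↦]-other γ t (∈-∉⇒≢ m x∉)))
    (sym ([↦]ty-fresh (∈⇒⊢ty (⊢ty⇒⊢ a) m) x∉)) (var-[]-⊢ ⊢γ m)

[]tm-⊢ : ∀ {Δ σ Γ t A} → Δ ⊢s σ ∶ Γ → Γ ⊢ t ∶ A → Δ ⊢ t [ σ ]tm ∶ (A [ σ ]ty)
[]tm-⊢ ⊢σ (tm-var _ m) = var-[]-⊢ ⊢σ m

[]ty-⊢ : ∀ {Δ σ Γ A} → Δ ⊢ → Δ ⊢s σ ∶ Γ → Γ ⊢ty A → Δ ⊢ty (A [ σ ]ty)
[]ty-⊢ wf ⊢σ (ty-⋆ _)       = ty-⋆ wf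
[]ty-⊢ wf ⊢σ (ty-arr a t u) = ty-arr ([]ty-⊢ wf ⊢σ a) ([]tm-⊢ ⊢σ t) ([]tm-⊢ ⊢σ u)

var-∘s : ∀ {Δ σ Γ x A} θ → Δ ⊢s σ ∶ Γ → x ∶ A ∈ Γ →
         var x [ σ ∘s θ ]tm ≡ (var x [ σ ]tm) [ θ ]tm
var-∘s θ (sub-ext {γ = γ} {x = x} {t = t} _ _ _) here =
  trans (var-[↦]-same x (γ ∘s θ) (t [ θ ]tm)) (cong (_[ θ ]tm) (sym (var-[↦]-same x γ t)))
var-∘s θ (sub-ext {γ = γ} {t = t} ⊢γ (ctx-ext _ x∉) _) (there m) =
  trans (var-[↦]-other (γ ∘s θ) (t [ θ ]tm) y≢x)
    (trans (var-∘s θ ⊢γ m) (cong (_[ θ ]tm) (sym (var-[↦]-other γ t y≢x))))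
  where y≢x = ∈-∉⇒≢ m x∉

[]tm-∘s : ∀ {Δ σ Γ t A} θ → Δ ⊢s σ ∶ Γ → Γ ⊢ t ∶ A → t [ σ ∘s θ ]tm ≡ (t [ σ ]tm) [ θ ]tm
[]tm-∘s θ ⊢σ (tm-var _ m) = var-∘s θ ⊢σ m

[]ty-∘s : ∀ {Δ σ Γ A} θ → Δ ⊢s σ ∶ Γ → Γ ⊢ty A → A [ σ ∘s θ ]ty ≡ (A [ σ ]ty) [ θ ]ty
[]ty-∘s θ ⊢σ (ty-⋆ _)       = refl
[]ty-∘s θ ⊢σ (ty-arr a t u) = arr-cong ([]ty-∘s θ ⊢σ a) ([]tm-∘s θ ⊢σ t) ([]tm-∘s θ ⊢σ u)

idSub-∘s-fresh : ∀ {x} Γ σ t → x ∉ Γ → idSub Γ ∘s ⟨ σ , x ↦ t ⟩ ≡ idSub Γ ∘s σ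
idSub-∘s-fresh ∅           σ t _          = refl
idSub-∘s-fresh (Γ , y ∶ B) σ t (x≢y , x∉) =
  cong₂ ⟨_, y ↦_⟩ (idSub-∘s-fresh Γ σ t x∉) (var-[↦]-other σ t (λ y≡x → x≢y (sym y≡x)))

idSub-∘s : ∀ {Δ σ Γ} → Δ ⊢s σ ∶ Γ → idSub Γ ∘s σ ≡ σ
idSub-∘s sub-⟨⟩ = refl
idSub-∘s {σ = ⟨ σ , x ↦ t ⟩} {Γ , x ∶ A} (sub-ext ⊢σ (ctx-ext _ x∉) _) =
  cong₂ ⟨_, x ↦_⟩ (trans (idSub-∘s-fresh Γ σ t x∉) (idSub-∘s ⊢σ)) (var-[↦]-same x σ t)

idSub-∘s-⟨,↦⟩ : ∀ {Δ σ Γ x A t} → Δ ⊢s ⟨ σ , x ↦ t ⟩ ∶ (Γ , x ∶ A) →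
                idSub Γ ∘s ⟨ σ , x ↦ t ⟩ ≡ σ
idSub-∘s-⟨,↦⟩ {Γ = Γ} (sub-ext ⊢σ (ctx-ext _ x∉) _) =
  trans (idSub-∘s-fresh Γ _ _ x∉) (idSub-∘s ⊢σ)

dim-[]ty : ∀ A σ → dim (A [ σ ]ty) ≡ dim A
dim-[]ty ⋆           σ = refl
dim-[]ty (arr A _ _) σ = cong (_+ℤ + 1) (dim-[]ty A σ)

Sphere-fresh : ∀ n {x} → 2 * n ≤ x → x ∉ Sphere n
Disk-fresh   : ∀ n {x} → suc (2 * n) ≤ x → x ∉ Disk n
Sphere-fresh zero    _ = tt
Sphere-fresh (suc n) p rewrite *-suc 2 n =
  (λ x≡ → <⇒≢ p (sym x≡)) , Disk-fresh n (≤-trans (n≤1+n _) p)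
Disk-fresh n p = (λ x≡ → <⇒≢ p (sym x≡)) , Sphere-fresh n (≤-trans (n≤1+n _) p)

Sphere-⊢ : ∀ n → Sphere n ⊢
U-⊢      : ∀ n → Sphere n ⊢ty U n
Disk-⊢   : ∀ n → Disk n ⊢
Disk-⊢ n = ctx-ext (U-⊢ n) (Sphere-fresh n ≤-refl)
Sphere-⊢ zero    = ctx-∅
Sphere-⊢ (suc n) = ctx-ext (wk-ty (Disk-⊢ n) (U-⊢ n)) (Disk-fresh n ≤-refl)
U-⊢ zero    = ty-⋆ ctx-∅
U-⊢ (suc n) = ty-arr (wk-ty (Sphere-⊢ (suc n)) (wk-ty (Disk-⊢ n) (U-⊢ n)))
  (tm-var (Sphere-⊢ (suc n)) (there here)) (tm-var (Sphere-⊢ (suc n)) here)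

d₂ₙ-⊢ : ∀ n → Disk n ⊢ var (2 * n) ∶ U n
d₂ₙ-⊢ n = tm-var (Disk-⊢ n) here

U-suc-[] : ∀ n σ a b → U (suc n) [ ⟨ ⟨ σ , 2 * n ↦ a ⟩ , suc (2 * n) ↦ b ⟩ ]ty ≡ arr (U n [ σ ]ty) a b
U-suc-[] n σ a b = arr-cong
  (trans ([↦]ty-fresh (U-⊢ n) (Sphere-fresh n (n≤1+n _))) ([↦]ty-fresh (U-⊢ n) (Sphere-fresh n ≤-refl)))
  (trans (var-[↦]-other σa b (<⇒≢ ≤-refl)) (var-[↦]-same (2 * n) σ a))
  (var-[↦]-same (suc (2 * n)) σa b)
  where σa = ⟨ σ , 2 * n ↦ a ⟩

depth : Ty → ℕ
depth ⋆           = zero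
depth (arr A _ _) = suc (depth A)

depth-U : ∀ n → depth (U n) ≡ n
depth-U zero    = refl
depth-U (suc n) = cong suc (depth-U n)

dim≡depth-1 : ∀ A → dim A ≡ + depth A -ℤ + 1
dim≡depth-1 ⋆           = refl
dim≡depth-1 (arr A _ _) = trans (cong (_+ℤ + 1) (dim≡depth-1 A)) (pred+1 (depth A))
  where
  -- for n = suc k the left side is  + (k + 1)  while the right side reduces to  + suc k
  pred+1 : ∀ n → (+ n -ℤ + 1) +ℤ + 1 ≡ + suc n -ℤ + 1
  pred+1 zero    = refl
  pred+1 (suc k) = cong +_ (+-comm k 1)

-1-injective : ∀ m n → + m -ℤ + 1 ≡ + n -ℤ + 1 → m ≡ n
-1-injective zero    zero    _    = refl
-1-injective (suc m) (suc n) refl = refl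

dim-U : ∀ n → dim (U n) ≡ + n -ℤ + 1
dim-U n = subst (λ k → dim (U n) ≡ + k -ℤ + 1) (depth-U n) (dim≡depth-1 (U n))

dim⇒depth : ∀ A n → dim A ≡ + n -ℤ + 1 → depth A ≡ n
dim⇒depth A n e = -1-injective (depth A) n (trans (sym (dim≡depth-1 A)) e)

U-[]-injective : ∀ n {Γ σ τ} → Γ ⊢s σ ∶ Sphere n → Γ ⊢s τ ∶ Sphere n →
                 U n [ σ ]ty ≡ U n [ τ ]ty → σ ≡ τ
U-[]-injective zero    sub-⟨⟩ sub-⟨⟩ _ = refl
U-[]-injective (suc n) (sub-ext (sub-ext {γ = σ} ⊢σ _ _) _ _) (sub-ext (sub-ext {γ = τ} ⊢τ _ _) _ _) e
  with arr-injective (trans (sym (U-suc-[] n σ _ _)) (trans e (U-suc-[] n τ _ _)))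
... | Uσ≡Uτ , refl , refl = cong (λ ρ → ⟨ ⟨ ρ , _ ↦ _ ⟩ , _ ↦ _ ⟩) (U-[]-injective n ⊢σ ⊢τ Uσ≡Uτ)

U-[]-surjective : ∀ {Γ A} → Γ ⊢ty A → Σ Sub (λ σ → (Γ ⊢s σ ∶ Sphere (depth A)) × (U (depth A) [ σ ]ty ≡ A))
U-[]-surjective (ty-⋆ _) = ⟨⟩ , sub-⟨⟩ , refl
U-[]-surjective {Γ} (ty-arr {t = t} {u} ⊢A ⊢t ⊢u) with U-[]-surjective ⊢A
... | σ , ⊢σ , Uσ≡A =
  ⟨ ⟨ σ , 2 * n ↦ t ⟩ , suc (2 * n) ↦ u ⟩ ,
  sub-ext (sub-ext ⊢σ (Disk-⊢ n) (subst (Γ ⊢ t ∶_) (sym Uσ≡A) ⊢t)) (Sphere-⊢ (suc n))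
    (subst (Γ ⊢ u ∶_) (sym (trans ([↦]ty-fresh (U-⊢ n) (Sphere-fresh n ≤-refl)) Uσ≡A)) ⊢u) ,
  trans (U-suc-[] n σ t u) (arr-cong Uσ≡A refl refl)
  where n = depth _

d₂ₙ-[]-⊢ : ∀ n {Γ σ χ} → Γ ⊢s σ ∶ Disk n → π n ∘s σ ≡ χ → Γ ⊢ var (2 * n) [ σ ]tm ∶ (U n [ χ ]ty)
d₂ₙ-[]-⊢ n {Γ} ⊢σt@(sub-ext {γ = σ} {t = t} _ _ ⊢t) πσ≡χ =
  subst₂ (Γ ⊢_∶_) (sym (var-[↦]-same (2 * n) σ t))
    (cong (U n [_]ty) (trans (sym (idSub-∘s-⟨,↦⟩ ⊢σt)) πσ≡χ)) ⊢t

d₂ₙ-[]-injective : ∀ n {Γ σ τ} → Γ ⊢s σ ∶ Disk n → Γ ⊢s τ ∶ Disk n → π n ∘s σ ≡ π n ∘s τ →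
                   var (2 * n) [ σ ]tm ≡ var (2 * n) [ τ ]tm → σ ≡ τ
d₂ₙ-[]-injective n ⊢σs@(sub-ext {γ = σ} {t = s} _ _ _) ⊢τt@(sub-ext {γ = τ} {t = t} _ _ _) πσ≡πτ e =
  cong₂ ⟨_, 2 * n ↦_⟩
    (trans (sym (idSub-∘s-⟨,↦⟩ ⊢σs)) (trans πσ≡πτ (idSub-∘s-⟨,↦⟩ ⊢τt)))
    (trans (sym (var-[↦]-same (2 * n) σ s)) (trans e (var-[↦]-same (2 * n) τ t)))

d₂ₙ-[]-surjective : ∀ n {Γ χ t} → Γ ⊢s χ ∶ Sphere n → Γ ⊢ t ∶ (U n [ χ ]ty) →
                    Σ Sub (λ σ → (Γ ⊢s σ ∶ Disk n) × (π n ∘s σ ≡ χ) × (var (2 * n) [ σ ]tm ≡ t))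
d₂ₙ-[]-surjective n {χ = χ} {t} ⊢χ ⊢t =
  ⟨ χ , 2 * n ↦ t ⟩ , ⊢χt , idSub-∘s-⟨,↦⟩ ⊢χt , var-[↦]-same (2 * n) χ t
  where ⊢χt = sub-ext ⊢χ (Disk-⊢ n) ⊢t

lemma2p7 : (n : ℕ) →
    ((Γ : Ctx) → Γ ⊢ →
        ((σ : Sub) → Γ ⊢s σ ∶ Sphere n →
           (Γ ⊢ty (U n [ σ ]ty)) × (dim (U n [ σ ]ty) ≡ + n -ℤ + 1))
      × ((σ τ : Sub) → Γ ⊢s σ ∶ Sphere n → Γ ⊢s τ ∶ Sphere n →
           U n [ σ ]ty ≡ U n [ τ ]ty → σ ≡ τ)
      × ((A : Ty) → Γ ⊢ty A → dim A ≡ + n -ℤ + 1 →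
           Σ Sub (λ σ → (Γ ⊢s σ ∶ Sphere n) × (U n [ σ ]ty ≡ A))))
    × ((Δ Γ : Ctx) (θ σ : Sub) → Δ ⊢ → Γ ⊢ → Δ ⊢s θ ∶ Γ → Γ ⊢s σ ∶ Sphere n →
        U n [ σ ∘s θ ]ty ≡ (U n [ σ ]ty) [ θ ]ty)
    × ((Γ : Ctx) → Γ ⊢ → (A : Ty) → Γ ⊢ty A → dim A ≡ + n -ℤ + 1 →
       (χ : Sub) → Γ ⊢s χ ∶ Sphere n → U n [ χ ]ty ≡ A →
        ((σ : Sub) → Γ ⊢s σ ∶ Disk n → π n ∘s σ ≡ χ →
           Γ ⊢ (var (2 * n) [ σ ]tm) ∶ A)
      × ((σ τ : Sub) → Γ ⊢s σ ∶ Disk n → π n ∘s σ ≡ χ →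
           Γ ⊢s τ ∶ Disk n → π n ∘s τ ≡ χ →
           var (2 * n) [ σ ]tm ≡ var (2 * n) [ τ ]tm → σ ≡ τ)
      × ((t : Tm) → Γ ⊢ t ∶ A →
           Σ Sub (λ σ → (Γ ⊢s σ ∶ Disk n) × (π n ∘s σ ≡ χ) × (var (2 * n) [ σ ]tm ≡ t))))
    × ((Δ Γ : Ctx) (θ σ : Sub) → Δ ⊢ → Γ ⊢ → Δ ⊢s θ ∶ Γ → Γ ⊢s σ ∶ Disk n →
        var (2 * n) [ σ ∘s θ ]tm ≡ (var (2 * n) [ σ ]tm) [ θ ]tm)
lemma2p7 n =
  (λ Γ wf →
     (λ σ ⊢σ → []ty-⊢ wf ⊢σ (U-⊢ n) , trans (dim-[]ty (U n) σ) (dim-U n)) ,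
     (λ σ τ → U-[]-injective n) ,
     (λ A ⊢A dimA → subst (λ k → Σ Sub (λ σ → (Γ ⊢s σ ∶ Sphere k) × (U k [ σ ]ty ≡ A)))
                          (dim⇒depth A n dimA) (U-[]-surjective ⊢A))) ,
  (λ Δ Γ θ σ _ _ _ ⊢σ → []ty-∘s θ ⊢σ (U-⊢ n)) ,
  (λ Γ _ A _ _ χ ⊢χ Uχ≡A →
     (λ σ ⊢σ πσ≡χ → subst (Γ ⊢ _ ∶_) Uχ≡A (d₂ₙ-[]-⊢ n ⊢σ πσ≡χ)) ,
     (λ σ τ ⊢σ πσ≡χ ⊢τ πτ≡χ → d₂ₙ-[]-injective n ⊢σ ⊢τ (trans πσ≡χ (sym πτ≡χ))) ,
     (λ t ⊢t → d₂ₙ-[]-surjective n ⊢χ (subst (Γ ⊢ t ∶_) (sym Uχ≡A) ⊢t))) ,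
  (λ Δ Γ θ σ _ _ _ ⊢σ → []tm-∘s θ ⊢σ (d₂ₙ-⊢ n))
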